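{- Each of the sets $IM_2$, $IR_2$, $IR_0$, $IR_1$ of relations on $\{0,1\}$ is a max-co-clone.
   Context: $IM_2$ is the set of all relations on $\{0,1\}$ closed under both componentwise conjunction $\wedge$ and componentwise disjunction $\vee$. $IR_2=\langle\langle\{\mathrm{EQ},\delta_0,\delta_1\}\rangle\rangle$, $IR_0=\langle\langle\{\mathrm{EQ},\delta_0\}\rangle\rangle$, $IR_1=\langle\langle\{\mathrm{EQ},\delta_1\}\rangle\rangle$, where $\langle\langle\Gamma\rangle\rangle$ is the smallest set containing $\Gamma$ and $\mathrm{EQ}=\{(0,0),(1,1)\}$ closed under manipulations with variables (renaming, permuting, identifying variables), conjunction and existential quantification; $\delta_0=\{(0)\}$, $\delta_1=\{(1)\}$. Max-implementation: for an $(n+m)$-ary $R$, $\exists_{\max}(y_1,\dots,y_m)R$ consists of those $\mathbf a\in\{0,1\}^n$ whose number of extensions $\mathbf b\in\{0,1\}^m$ with $(\mathbf a,\mathbf b)\in R$ is maximal over all of $\{0,1\}^n$. A max-co-clone is a set of relations containing $\mathrm{EQ}$ and closed under manipulations with variables, conjunction and max-implementation. -}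

module Defs where

open import Data.Bool using (Bool; true; false; _∧_; _∨_; not; _xor_)
open import Data.Nat using (ℕ; zero; suc; _+_; _≤ᵇ_)
open import Data.Fin using (Fin)
open import Data.Vec using (Vec; []; _∷_; _++_; lookup; tabulate; zipWith)
open import Data.List using (List; []; _∷_; map; concatMap; length; filter)
open import Data.Bool.ListAction using (all; any)
open import Relation.Binary.PropositionalEquality using (_≡_)
open import Data.Bool.Properties using () renaming (_≟_ to _≟B_)
open import Data.Product using (_×_)

-- A relation of arity n on {0,1} (false = 0, true = 1), given by its
-- characteristic function: a ∈ R iff R a ≡ true.
Rel : ℕ → Set
Rel n = Vec Bool n → Bool

RelSet : Set₁
RelSet = (n : ℕ) → Rel n → Set

allVecs : (m : ℕ) → List (Vec Bool m)
allVecs zero    = [] ∷ []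
allVecs (suc m) = concatMap (λ v → (false ∷ v) ∷ (true ∷ v) ∷ []) (allVecs m)

EQ : Rel 2
EQ (a ∷ b ∷ []) = not (a xor b)

δ₀ : Rel 1
δ₀ (a ∷ []) = not a

δ₁ : Rel 1
δ₁ (a ∷ []) = a

reindex : ∀ {n k} → (Fin n → Fin k) → Vec Bool k → Vec Bool n
reindex f x = tabulate (λ i → lookup x (f i))

-- Manipulation with variables (renaming, permuting, identifying variables,
-- and, for non-surjective f, adding dummy variables):
-- (manip f R)(x₁..x_k) = R(x_{f 1}, ..., x_{f n}).
manip : ∀ {n k} → (Fin n → Fin k) → Rel n → Rel k
manip f R x = R (reindex f x)

conj : ∀ {n m k} → (Fin n → Fin k) → (Fin m → Fin k) → Rel n → Rel m → Rel k
conj f g R S x = R (reindex f x) ∧ S (reindex g x)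

exQ : ∀ n m → Rel (n + m) → Rel n
exQ n m R a = any (λ b → R (a ++ b)) (allVecs m)

count : ∀ n m → Rel (n + m) → Vec Bool n → ℕ
count n m R a = length (filter (λ b → R (a ++ b) ≟B true) (allVecs m))

maxImpl : ∀ n m → Rel (n + m) → Rel n
maxImpl n m R a = all (λ a' → count n m R a' ≤ᵇ count n m R a) (allVecs n)

record MaxCoClone (C : RelSet) : Set₁ where
  field
    hasEQ   : C 2 EQ
    closedManip : ∀ {n k} (f : Fin n → Fin k) (R : Rel n) → C n R → C k (manip f R)
    closedConj  : ∀ {n m k} (f : Fin n → Fin k) (g : Fin m → Fin k) (R : Rel n) (S : Rel m) →
                  C n R → C m S → C k (conj f g R S)
    closedMax   : ∀ n m (R : Rel (n + m)) → C (n + m) R → C n (maxImpl n m R)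

IM₂ : RelSet
IM₂ n R = (∀ x y → R x ≡ true → R y ≡ true → R (zipWith _∧_ x y) ≡ true)
        × (∀ x y → R x ≡ true → R y ≡ true → R (zipWith _∨_ x y) ≡ true)

-- ⟨⟨Γ⟩⟩: the smallest set of relations containing Γ and EQ, closed under
-- manipulations with variables, conjunction and existential quantification
-- (and, since relations are sets of tuples, under extensional equality).
data ⟪_⟫ (Γ : RelSet) : RelSet where
  gen   : ∀ {n} {R : Rel n} → Γ n R → ⟪ Γ ⟫ n R
  eq    : ⟪ Γ ⟫ 2 EQ
  man   : ∀ {n k} (f : Fin n → Fin k) {R : Rel n} → ⟪ Γ ⟫ n R → ⟪ Γ ⟫ k (manip f R)
  cnj   : ∀ {n m k} (f : Fin n → Fin k) (g : Fin m → Fin k) {R : Rel n} {S : Rel m} →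
          ⟪ Γ ⟫ n R → ⟪ Γ ⟫ m S → ⟪ Γ ⟫ k (conj f g R S)
  ex    : ∀ n m {R : Rel (n + m)} → ⟪ Γ ⟫ (n + m) R → ⟪ Γ ⟫ n (exQ n m R)
  ext   : ∀ {n} {R S : Rel n} → (∀ x → R x ≡ S x) → ⟪ Γ ⟫ n R → ⟪ Γ ⟫ n S

data Γ₂ : RelSet where
  d₀ : Γ₂ 1 δ₀
  d₁ : Γ₂ 1 δ₁

data Γ₀ : RelSet where
  d₀ : Γ₀ 1 δ₀

data Γ₁ : RelSet where
  d₁ : Γ₁ 1 δ₁

IR₂ IR₀ IR₁ : RelSet
IR₂ = ⟪ Γ₂ ⟫
IR₀ = ⟪ Γ₀ ⟫
IR₁ = ⟪ Γ₁ ⟫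

module Submission where

-- All four sets contain EQ and are closed under manipulation of variables
-- and conjunction; the content is closure under max-implementation.  Both
-- halves are organised around polymorphisms: a k-ary operation φ acting
-- componentwise on k tuples, and the fact that EQ is preserved by every φ
-- while preservation survives manipulations, conjunction and ∃, so that a
-- polymorphism of Γ is one of ⟪ Γ ⟫.
--
-- By the four functions theorem of
-- Ahlswede and Daykin the number of extensions count(a) of a tuple a is
-- log-supermodular, count(a)·count(a') ≤ count(a ∧ a')·count(a ∨ a'); the
-- maximisers of such a function form a sublattice, so ∃_max R is in IM₂.
--
-- Each relation of ⟪ Γ ⟫ is affine (preserved by x ⊕ y ⊕ z),
-- since δ₀ and δ₁ are.  For affine R a translation of the cube maps the
-- extensions of one tuple onto those of any other tuple having extensions,
-- so all nonzero counts are equal and ∃_max R = ∃ R; if no tuple has an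
-- extension then ∃_max R is the total relation ∃ y₁ y₂ EQ(y₁, y₂).

open import Defs
open import Data.Bool using (Bool; true; false; _∧_; _∨_; not; _xor_)
open import Data.Bool.Properties using (T-≡; xor-same; xor-assoc) renaming (_≟_ to _≟B_)
open import Data.Nat using (ℕ; zero; suc; _+_; _*_; _≤_; z≤n)
open import Data.Nat.Properties
  using ( ≤-refl; ≤-trans; ≤-reflexive; module ≤-Reasoning; ≤ᵇ⇒≤; ≤⇒≤ᵇ; n≤0⇒n≡0
        ; m≤m+n; m≤n+m; m≤n⇒∃[o]m+o≡n; +-comm; +-assoc; +-identityʳ; +-mono-≤; +-monoʳ-≤
        ; *-comm; *-distribˡ-+; *-mono-≤; *-monoʳ-≤; *-cancelˡ-≤; *-cancelʳ-≤ )
open import Data.Nat.Tactic.RingSolver using (solve-∀)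
open import Data.Fin using (Fin; zero; suc; _↑ˡ_; _↑ʳ_)
open import Data.Vec using (Vec; []; _∷_; _++_; lookup; tabulate; zipWith)
open import Data.Vec.Properties
  using (lookup∘tabulate; tabulate∘lookup; tabulate-cong; lookup-zipWith; lookup-++ˡ; lookup-++ʳ; zipWith-++)
open import Data.List using (List; []; _∷_; map; concatMap; length; filter)
open import Data.Nat.ListAction using (sum)
open import Data.Bool.ListAction using (all; any)
open import Data.List.Membership.Propositional using (_∈_; lose; find)
open import Data.List.Membership.Propositional.Properties using (∈-concatMap⁺)
open import Data.List.Relation.Unary.Any using (here; there)
import Data.List.Relation.Unary.All as All
open import Data.List.Relation.Unary.All.Properties using (all⁺; all⁻)
open import Data.List.Relation.Unary.Any.Properties using (any⁺; any⁻)
open import Data.Product using (Σ; _×_; _,_; proj₁; proj₂)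
open import Data.Sum using (_⊎_; inj₁; inj₂)
open import Function using (Equivalence)
open import Relation.Nullary using (contradiction)
open import Relation.Binary.PropositionalEquality
  using (_≡_; refl; sym; trans; cong; cong₂; subst; subst₂; module ≡-Reasoning)

𝟙 : Bool → ℕ
𝟙 true  = 1
𝟙 false = 0

∧-true : ∀ {a b} → a ∧ b ≡ true → a ≡ true × b ≡ true
∧-true {true} {true} _ = refl , refl

EQ-sound : ∀ v → EQ v ≡ true → lookup v zero ≡ lookup v (suc zero)
EQ-sound (false ∷ false ∷ []) _ = refl
EQ-sound (true  ∷ true  ∷ []) _ = refl

EQ-refl : ∀ a → EQ (a ∷ a ∷ []) ≡ true
EQ-refl false = refl
EQ-refl true  = refl

lookup-ext : ∀ {A : Set} {n} {u v : Vec A n} → (∀ i → lookup u i ≡ lookup v i) → u ≡ v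
lookup-ext {u = u} {v} e = trans (sym (tabulate∘lookup u)) (trans (tabulate-cong e) (tabulate∘lookup v))

++-ext : ∀ {A : Set} {n m} (u : Vec A n) (v : Vec A m) (w : Vec A (n + m)) →
         (∀ i → lookup w (i ↑ˡ m) ≡ lookup u i) → (∀ j → lookup w (n ↑ʳ j) ≡ lookup v j) →
         w ≡ u ++ v
++-ext []      v w       _  er = lookup-ext er
++-ext (x ∷ u) v (y ∷ w) el er = cong₂ _∷_ (el zero) (++-ext u v w (λ i → el (suc i)) er)

Op : ℕ → Set
Op k = Vec Bool k → Bool

column : ∀ {k n} → (Fin k → Vec Bool n) → Fin n → Vec Bool k
column xs i = tabulate (λ j → lookup (xs j) i)

_⊙_ : ∀ {k n} → Op k → (Fin k → Vec Bool n) → Vec Bool n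
φ ⊙ xs = tabulate (λ i → φ (column xs i))

Preserves : ∀ {k} → Op k → ∀ {n} → Rel n → Set
Preserves {k} φ {n} R = (xs : Fin k → Vec Bool n) → (∀ j → R (xs j) ≡ true) → R (φ ⊙ xs) ≡ true

lookup-⊙ : ∀ {k n} (φ : Op k) (xs : Fin k → Vec Bool n) i → lookup (φ ⊙ xs) i ≡ φ (column xs i)
lookup-⊙ φ xs = lookup∘tabulate _

reindex-⊙ : ∀ {k n l} (φ : Op k) (f : Fin n → Fin l) (xs : Fin k → Vec Bool l) →
            reindex f (φ ⊙ xs) ≡ φ ⊙ (λ j → reindex f (xs j))
reindex-⊙ φ f xs = tabulate-cong λ i →
  trans (lookup-⊙ φ xs (f i)) (cong φ (tabulate-cong λ j → sym (lookup∘tabulate _ i)))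

⊙-++ : ∀ {k n m} (φ : Op k) (xs : Fin k → Vec Bool n) (ys : Fin k → Vec Bool m) →
       φ ⊙ (λ j → xs j ++ ys j) ≡ φ ⊙ xs ++ φ ⊙ ys
⊙-++ {n = n} {m} φ xs ys = ++-ext (φ ⊙ xs) (φ ⊙ ys) _
  (λ i → trans (lookup-⊙ φ xys (i ↑ˡ m))
    (trans (cong φ (tabulate-cong λ j → lookup-++ˡ (xs j) (ys j) i)) (sym (lookup-⊙ φ xs i))))
  (λ i → trans (lookup-⊙ φ xys (n ↑ʳ i))
    (trans (cong φ (tabulate-cong λ j → lookup-++ʳ (xs j) (ys j) i)) (sym (lookup-⊙ φ ys i))))
  where
  xys : Fin _ → Vec Bool (n + m)
  xys j = xs j ++ ys j

∈-allVecs : ∀ {m} (v : Vec Bool m) → v ∈ allVecs m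
∈-allVecs []          = here refl
∈-allVecs (false ∷ v) = ∈-concatMap⁺ _ (lose (∈-allVecs v) (here refl))
∈-allVecs (true ∷ v)  = ∈-concatMap⁺ _ (lose (∈-allVecs v) (there (here refl)))

all-cube⁻ : ∀ m (p : Vec Bool m → Bool) → all p (allVecs m) ≡ true → ∀ v → p v ≡ true
all-cube⁻ m p h v = Equivalence.to T-≡
  (All.lookup (all⁺ p (allVecs m) (Equivalence.from T-≡ h)) (∈-allVecs v))

all-cube⁺ : ∀ m (p : Vec Bool m → Bool) → (∀ v → p v ≡ true) → all p (allVecs m) ≡ true
all-cube⁺ m p h = Equivalence.to T-≡
  (all⁻ p {allVecs m} (All.tabulate λ {v} _ → Equivalence.from T-≡ (h v)))

any-cube⁻ : ∀ m (p : Vec Bool m → Bool) → any p (allVecs m) ≡ true → Σ (Vec Bool m) λ v → p v ≡ true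
any-cube⁻ m p h with find (any⁻ p (allVecs m) (Equivalence.from T-≡ h))
... | v , _ , pv = v , Equivalence.to T-≡ pv

any-cube⁺ : ∀ m (p : Vec Bool m → Bool) v → p v ≡ true → any p (allVecs m) ≡ true
any-cube⁺ m p v pv = Equivalence.to T-≡ (any⁺ p (lose (∈-allVecs v) (Equivalence.from T-≡ pv)))

any-none : ∀ {A : Set} (p : A → Bool) (xs : List A) → (∀ x → p x ≡ false) → any p xs ≡ false
any-none p []       _    = refl
any-none p (x ∷ xs) none rewrite none x = any-none p xs none

any-cube-false : ∀ m (p : Vec Bool m → Bool) → any p (allVecs m) ≡ false → ∀ v → p v ≡ false
any-cube-false m p h v with p v in pv
... | false = refl
... | true  = trans (sym (any-cube⁺ m p v pv)) h

cube-dichotomy : ∀ m (p : Vec Bool m → Bool) → (Σ (Vec Bool m) λ v → p v ≡ true) ⊎ (∀ v → p v ≡ false)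
cube-dichotomy m p with any p (allVecs m) in h
... | true  = inj₁ (any-cube⁻ m p h)
... | false = inj₂ (any-cube-false m p h)

preserves-EQ : ∀ {k} (φ : Op k) → Preserves φ EQ
preserves-EQ φ xs h = subst (λ c → EQ (φ (column xs zero) ∷ φ c ∷ []) ≡ true)
  (tabulate-cong λ j → EQ-sound (xs j) (h j)) (EQ-refl (φ (column xs zero)))

preserves-manip : ∀ {k n l} (φ : Op k) (f : Fin n → Fin l) (R : Rel n) →
                  Preserves φ R → Preserves φ (manip f R)
preserves-manip φ f R pR xs h =
  subst (λ v → R v ≡ true) (sym (reindex-⊙ φ f xs)) (pR _ h)

preserves-conj : ∀ {k n m l} (φ : Op k) (f : Fin n → Fin l) (g : Fin m → Fin l) (R : Rel n) (S : Rel m) →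
                 Preserves φ R → Preserves φ S → Preserves φ (conj f g R S)
preserves-conj φ f g R S pR pS xs h = cong₂ _∧_
  (preserves-manip φ f R pR xs (λ j → proj₁ (∧-true (h j))))
  (preserves-manip φ g S pS xs (λ j → proj₂ (∧-true (h j))))

preserves-exQ : ∀ {k} (φ : Op k) n m (R : Rel (n + m)) → Preserves φ R → Preserves φ (exQ n m R)
preserves-exQ φ n m R pR xs h = any-cube⁺ m (λ b → R (φ ⊙ xs ++ b)) (φ ⊙ ys)
  (subst (λ v → R v ≡ true) (⊙-++ φ xs ys) (pR _ λ j → proj₂ (witness j)))
  where
  witness : ∀ j → Σ (Vec Bool m) λ b → R (xs j ++ b) ≡ true
  witness j = any-cube⁻ m _ (h j)
  ys : Fin _ → Vec Bool m
  ys j = proj₁ (witness j)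

preserves-⟪⟫ : ∀ {k} (φ : Op k) {Γ : RelSet} → (∀ {n R} → Γ n R → Preserves φ R) →
               ∀ {n R} → ⟪ Γ ⟫ n R → Preserves φ R
preserves-⟪⟫ φ pΓ (gen r)                   = pΓ r
preserves-⟪⟫ φ pΓ eq                        = preserves-EQ φ
preserves-⟪⟫ φ pΓ (man f {R} r)             = preserves-manip φ f R (preserves-⟪⟫ φ pΓ r)
preserves-⟪⟫ φ pΓ (cnj f g {R} {S} r s)     =
  preserves-conj φ f g R S (preserves-⟪⟫ φ pΓ r) (preserves-⟪⟫ φ pΓ s)
preserves-⟪⟫ φ pΓ (ex n m {R} r)            = preserves-exQ φ n m R (preserves-⟪⟫ φ pΓ r)
preserves-⟪⟫ φ pΓ (ext e r) xs h =
  trans (sym (e _)) (preserves-⟪⟫ φ pΓ r xs λ j → trans (e (xs j)) (h j))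

∑ : ∀ m → (Vec Bool m → ℕ) → ℕ
∑ zero    f = f []
∑ (suc m) f = ∑ m (λ v → f (false ∷ v) + f (true ∷ v))

∑-cong : ∀ m {f g : Vec Bool m → ℕ} → (∀ v → f v ≡ g v) → ∑ m f ≡ ∑ m g
∑-cong zero    e = e []
∑-cong (suc m) e = ∑-cong m λ v → cong₂ _+_ (e (false ∷ v)) (e (true ∷ v))

∑-mono : ∀ m {f g : Vec Bool m → ℕ} → (∀ v → f v ≤ g v) → ∑ m f ≤ ∑ m g
∑-mono zero    le = le []
∑-mono (suc m) le = ∑-mono m λ v → +-mono-≤ (le (false ∷ v)) (le (true ∷ v))

∑-zero : ∀ m {f : Vec Bool m → ℕ} → (∀ v → f v ≡ 0) → ∑ m f ≡ 0
∑-zero zero    e = e []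
∑-zero (suc m) e = ∑-zero m λ v → cong₂ _+_ (e (false ∷ v)) (e (true ∷ v))

term≤∑ : ∀ m (f : Vec Bool m → ℕ) v → f v ≤ ∑ m f
term≤∑ zero    f []      = ≤-refl
term≤∑ (suc m) f (false ∷ v) = ≤-trans (m≤m+n (f (false ∷ v)) _) (term≤∑ m _ v)
term≤∑ (suc m) f (true ∷ v)  = ≤-trans (m≤n+m (f (true ∷ v)) _) (term≤∑ m _ v)

-- Translation b ↦ b ⊕ c is a bijection of the cube, so it does not change sums.
_⊕_ : ∀ {m} → Vec Bool m → Vec Bool m → Vec Bool m
_⊕_ = zipWith _xor_

∑-translate : ∀ m (f : Vec Bool m → ℕ) (c : Vec Bool m) → ∑ m (λ b → f (b ⊕ c)) ≡ ∑ m f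
∑-translate zero    f []          = refl
∑-translate (suc m) f (false ∷ c) = ∑-translate m (λ v → f (false ∷ v) + f (true ∷ v)) c
∑-translate (suc m) f (true ∷ c)  =
  trans (∑-cong m λ v → +-comm (f (true ∷ v ⊕ c)) (f (false ∷ v ⊕ c)))
        (∑-translate m (λ v → f (false ∷ v) + f (true ∷ v)) c)

length-filter : ∀ {A : Set} (p : A → Bool) (xs : List A) →
                length (filter (λ x → p x ≟B true) xs) ≡ sum (map (λ x → 𝟙 (p x)) xs)
length-filter p []       = refl
length-filter p (x ∷ xs) with p x
... | true  = cong suc (length-filter p xs)
... | false = length-filter p xs

sum-allVecs : ∀ m (f : Vec Bool m → ℕ) → sum (map f (allVecs m)) ≡ ∑ m f
sum-allVecs zero    f = +-identityʳ (f [])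
sum-allVecs (suc m) f = trans (sum-pairs (allVecs m)) (sum-allVecs m _)
  where
  sum-pairs : ∀ xs → sum (map f (concatMap (λ v → (false ∷ v) ∷ (true ∷ v) ∷ []) xs))
                   ≡ sum (map (λ v → f (false ∷ v) + f (true ∷ v)) xs)
  sum-pairs []       = refl
  sum-pairs (v ∷ xs) = trans (sym (+-assoc (f (false ∷ v)) (f (true ∷ v)) _))
                             (cong (f (false ∷ v) + f (true ∷ v) +_) (sum-pairs xs))

count≡∑ : ∀ n m (R : Rel (n + m)) a → count n m R a ≡ ∑ m (λ b → 𝟙 (R (a ++ b)))
count≡∑ n m R a = trans (length-filter (λ b → R (a ++ b)) (allVecs m)) (sum-allVecs m _)

-- (P ∸ u)(P ∸ v) ≥ 0, rearranged so as to stay within ℕ (write P = u + s).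
product-bound : ∀ P u v → u ≤ P → v ≤ P → P * u + P * v ≤ P * P + u * v
product-bound P u v u≤P v≤P with m≤n⇒∃[o]m+o≡n u≤P
... | s , refl = begin
  (u + s) * u + (u + s) * v         ≡⟨ expandˡ u s v ⟩
  (u + s) * u + u * v + s * v       ≤⟨ +-monoʳ-≤ ((u + s) * u + u * v) (*-monoʳ-≤ s v≤P) ⟩
  (u + s) * u + u * v + s * (u + s) ≡⟨ expandʳ u s v ⟩
  (u + s) * (u + s) + u * v         ∎
  where
  open ≤-Reasoning
  expandˡ : ∀ u s v → (u + s) * u + (u + s) * v ≡ (u + s) * u + u * v + s * v
  expandˡ = solve-∀
  expandʳ : ∀ u s v → (u + s) * u + u * v + s * (u + s) ≡ (u + s) * (u + s) + u * v
  expandʳ = solve-∀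

sum-bound : ∀ P Q u v → u ≤ P → v ≤ P → u * v ≤ P * Q → u + v ≤ P + Q
sum-bound zero      Q u v u≤0 v≤0 _ rewrite n≤0⇒n≡0 u≤0 | n≤0⇒n≡0 v≤0 = z≤n
sum-bound P@(suc _) Q u v u≤P v≤P uv≤PQ = *-cancelˡ-≤ P (begin
  P * (u + v)         ≡⟨ *-distribˡ-+ P u v ⟩
  P * u + P * v       ≤⟨ product-bound P u v u≤P v≤P ⟩
  P * P + u * v       ≤⟨ +-monoʳ-≤ (P * P) uv≤PQ ⟩
  P * P + P * Q       ≡⟨ *-distribˡ-+ P P Q ⟨
  P * (P + Q)         ∎)
  where open ≤-Reasoning

four-functions-base : ∀ a₀ a₁ b₀ b₁ c₀ c₁ e₀ e₁ →
  a₀ * b₀ ≤ c₀ * e₀ → a₀ * b₁ ≤ c₀ * e₁ → a₁ * b₀ ≤ c₀ * e₁ → a₁ * b₁ ≤ c₁ * e₁ →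
  (a₀ + a₁) * (b₀ + b₁) ≤ (c₀ + c₁) * (e₀ + e₁)
four-functions-base a₀ a₁ b₀ b₁ c₀ c₁ e₀ e₁ h₀₀ h₀₁ h₁₀ h₁₁ = begin
  (a₀ + a₁) * (b₀ + b₁)                       ≡⟨ expand a₀ a₁ b₀ b₁ ⟩
  a₀ * b₀ + a₁ * b₁ + (a₀ * b₁ + a₁ * b₀)     ≤⟨ +-mono-≤ (+-mono-≤ h₀₀ h₁₁)
                                                   (sum-bound _ _ _ _ h₀₁ h₁₀ cross) ⟩
  c₀ * e₀ + c₁ * e₁ + (c₀ * e₁ + c₁ * e₀)     ≡⟨ expand c₀ c₁ e₀ e₁ ⟨
  (c₀ + c₁) * (e₀ + e₁)                       ∎
  where
  open ≤-Reasoning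
  expand : ∀ a₀ a₁ b₀ b₁ → (a₀ + a₁) * (b₀ + b₁) ≡ a₀ * b₀ + a₁ * b₁ + (a₀ * b₁ + a₁ * b₀)
  expand = solve-∀
  regroup : ∀ a₀ a₁ b₀ b₁ → a₀ * b₁ * (a₁ * b₀) ≡ a₀ * b₀ * (a₁ * b₁)
  regroup = solve-∀
  -- the mixed terms have the same product as the pure ones
  cross : a₀ * b₁ * (a₁ * b₀) ≤ c₀ * e₁ * (c₁ * e₀)
  cross = begin
    a₀ * b₁ * (a₁ * b₀) ≡⟨ regroup a₀ a₁ b₀ b₁ ⟩
    a₀ * b₀ * (a₁ * b₁) ≤⟨ *-mono-≤ h₀₀ h₁₁ ⟩
    c₀ * e₀ * (c₁ * e₁) ≡⟨ regroup c₀ c₁ e₀ e₁ ⟨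
    c₀ * e₁ * (c₁ * e₀) ∎

four-functions : ∀ m (α β γ δ : Vec Bool m → ℕ) →
  (∀ x y → α x * β y ≤ γ (zipWith _∧_ x y) * δ (zipWith _∨_ x y)) →
  ∑ m α * ∑ m β ≤ ∑ m γ * ∑ m δ
four-functions zero    α β γ δ h = h [] []
four-functions (suc m) α β γ δ h = four-functions m _ _ _ _ λ x y →
  four-functions-base (α (false ∷ x)) (α (true ∷ x)) (β (false ∷ y)) (β (true ∷ y))
    (γ (false ∷ zipWith _∧_ x y)) (γ (true ∷ zipWith _∧_ x y))
    (δ (false ∷ zipWith _∨_ x y)) (δ (true ∷ zipWith _∨_ x y))
    (h (false ∷ x) (false ∷ y)) (h (false ∷ x) (true ∷ y))
    (h (true ∷ x) (false ∷ y))  (h (true ∷ x) (true ∷ y))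

Maximal : ∀ {n} → (Vec Bool n → ℕ) → Vec Bool n → Set
Maximal C a = ∀ z → C z ≤ C a

maxImpl-sound : ∀ n m (R : Rel (n + m)) a → maxImpl n m R a ≡ true → Maximal (count n m R) a
maxImpl-sound n m R a h z = ≤ᵇ⇒≤ _ _ (Equivalence.from T-≡ (all-cube⁻ n _ h z))

maxImpl-complete : ∀ n m (R : Rel (n + m)) a → Maximal (count n m R) a → maxImpl n m R a ≡ true
maxImpl-complete n m R a max = all-cube⁺ n _ λ z → Equivalence.to T-≡ (≤⇒≤ᵇ (max z))

-- The maximisers of a log-supermodular function form a sublattice:
-- with M = C a = C a', M² ≤ C a C a' ≤ C (a ∧ a') C (a ∨ a'), and both
-- factors on the right are at most M, so both equal M.

squeeze : ∀ M p q → M * M ≤ p * q → q ≤ M → M ≤ p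
squeeze zero        p q _     _   = z≤n
squeeze M@(suc _)   p q M²≤pq q≤M = *-cancelʳ-≤ M p M (≤-trans M²≤pq (*-monoʳ-≤ p q≤M))

argmax-sublattice : ∀ {n} (C : Vec Bool n → ℕ) →
  (∀ a a' → C a * C a' ≤ C (zipWith _∧_ a a') * C (zipWith _∨_ a a')) →
  ∀ {a a'} → Maximal C a → Maximal C a' →
  Maximal C (zipWith _∧_ a a') × Maximal C (zipWith _∨_ a a')
argmax-sublattice C super {a} {a'} max max' =
  (λ z → ≤-trans (max z) (squeeze (C a) (C meet) (C join) M²≤ (max join))) ,
  (λ z → ≤-trans (max z) (squeeze (C a) (C join) (C meet) M²≤' (max meet)))
  where
  meet join : Vec Bool _
  meet = zipWith _∧_ a a'
  join = zipWith _∨_ a a'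
  M²≤ : C a * C a ≤ C meet * C join
  M²≤ = ≤-trans (*-monoʳ-≤ (C a) (max' a)) (super a a')
  M²≤' : C a * C a ≤ C join * C meet
  M²≤' = ≤-trans M²≤ (≤-reflexive (*-comm (C meet) (C join)))

Closed : (Bool → Bool → Bool) → ∀ {n} → Rel n → Set
Closed op R = ∀ x y → R x ≡ true → R y ≡ true → R (zipWith op x y) ≡ true

binary : (Bool → Bool → Bool) → Op 2
binary op (a ∷ b ∷ []) = op a b

binary-⊙ : ∀ {n} (op : Bool → Bool → Bool) (xs : Fin 2 → Vec Bool n) →
           binary op ⊙ xs ≡ zipWith op (xs zero) (xs (suc zero))
binary-⊙ op xs = lookup-ext λ i →
  trans (lookup-⊙ (binary op) xs i) (sym (lookup-zipWith op i (xs zero) (xs (suc zero))))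

closed⇒preserves : ∀ op {n} {R : Rel n} → Closed op R → Preserves (binary op) R
closed⇒preserves op {R = R} c xs h =
  subst (λ v → R v ≡ true) (sym (binary-⊙ op xs)) (c _ _ (h zero) (h (suc zero)))

preserves⇒closed : ∀ op {n} {R : Rel n} → Preserves (binary op) R → Closed op R
preserves⇒closed op {R = R} p x y hx hy =
  subst (λ v → R v ≡ true) (binary-⊙ op xy) (p xy λ { zero → hx ; (suc zero) → hy })
  where
  xy : Fin 2 → Vec Bool _
  xy = lookup (x ∷ y ∷ [])

closed-EQ : ∀ op → Closed op EQ
closed-EQ op = preserves⇒closed op (preserves-EQ (binary op))

closed-manip : ∀ op {n k} (f : Fin n → Fin k) (R : Rel n) → Closed op R → Closed op (manip f R)
closed-manip op f R c = preserves⇒closed op (preserves-manip (binary op) f R (closed⇒preserves op c))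

closed-conj : ∀ op {n m k} (f : Fin n → Fin k) (g : Fin m → Fin k) (R : Rel n) (S : Rel m) →
              Closed op R → Closed op S → Closed op (conj f g R S)
closed-conj op f g R S cR cS = preserves⇒closed op
  (preserves-conj (binary op) f g R S (closed⇒preserves op cR) (closed⇒preserves op cS))

𝟙-product : ∀ {p q r s} → (p ≡ true → q ≡ true → r ≡ true) → (p ≡ true → q ≡ true → s ≡ true) →
            𝟙 p * 𝟙 q ≤ 𝟙 r * 𝟙 s
𝟙-product {false}        _  _  = z≤n
𝟙-product {true} {false} _  _  = z≤n
𝟙-product {true} {true}  hr hs rewrite hr refl refl | hs refl refl = ≤-refl

count-supermodular : ∀ n m (R : Rel (n + m)) → IM₂ (n + m) R → ∀ a a' →
  count n m R a * count n m R a' ≤ count n m R (zipWith _∧_ a a') * count n m R (zipWith _∨_ a a')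
count-supermodular n m R (c∧ , c∨) a a' =
  subst₂ _≤_ (sym (cong₂ _*_ (count≡∑ n m R a) (count≡∑ n m R a')))
             (sym (cong₂ _*_ (count≡∑ n m R _) (count≡∑ n m R _)))
    (four-functions m _ _ _ _ λ x y → 𝟙-product
      (λ hx hy → subst (λ v → R v ≡ true) (zipWith-++ _∧_ a x a' y) (c∧ _ _ hx hy))
      (λ hx hy → subst (λ v → R v ≡ true) (zipWith-++ _∨_ a x a' y) (c∨ _ _ hx hy)))

IM₂-closedMax : ∀ n m (R : Rel (n + m)) → IM₂ (n + m) R → IM₂ n (maxImpl n m R)
IM₂-closedMax n m R im =
  (λ a a' ha ha' → maxImpl-complete n m R _ (proj₁ (maximisers a a' ha ha'))) ,
  (λ a a' ha ha' → maxImpl-complete n m R _ (proj₂ (maximisers a a' ha ha')))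
  where
  C : Vec Bool n → ℕ
  C = count n m R
  maximisers : ∀ a a' → maxImpl n m R a ≡ true → maxImpl n m R a' ≡ true →
               Maximal C (zipWith _∧_ a a') × Maximal C (zipWith _∨_ a a')
  maximisers a a' ha ha' = argmax-sublattice C (count-supermodular n m R im)
    (maxImpl-sound n m R a ha) (maxImpl-sound n m R a' ha')

IM₂-maxCoClone : MaxCoClone IM₂
IM₂-maxCoClone = record
  { hasEQ       = closed-EQ _∧_ , closed-EQ _∨_
  ; closedManip = λ f R (c∧ , c∨) → closed-manip _∧_ f R c∧ , closed-manip _∨_ f R c∨
  ; closedConj  = λ f g R S (r∧ , r∨) (s∧ , s∨) →
                    closed-conj _∧_ f g R S r∧ s∧ , closed-conj _∨_ f g R S r∨ s∨
  ; closedMax   = IM₂-closedMax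
  }

xor₃ : Op 3
xor₃ (a ∷ b ∷ c ∷ []) = a xor b xor c

Affine : ∀ {n} → Rel n → Set
Affine = Preserves xor₃

-- δ₀ and δ₁ are affine: x ⊕ x ⊕ x = x.
affine-δ₀ : Affine δ₀
affine-δ₀ xs h =
  subst (λ c → not (xor₃ c) ≡ true) (sym (tabulate-cong λ j → zero-entry (xs j) (h j))) refl
  where
  zero-entry : ∀ v → δ₀ v ≡ true → lookup v zero ≡ false
  zero-entry (false ∷ []) _ = refl

affine-δ₁ : Affine δ₁
affine-δ₁ xs h =
  subst (λ c → xor₃ c ≡ true) (sym (tabulate-cong λ j → one-entry (xs j) (h j))) refl
  where
  one-entry : ∀ v → δ₁ v ≡ true → lookup v zero ≡ true
  one-entry (true ∷ []) _ = refl

triple : ∀ {n} → Vec Bool n → Vec Bool n → Vec Bool n → Fin 3 → Vec Bool n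
triple x y z = lookup (x ∷ y ∷ z ∷ [])

xor₃-translate : ∀ {n} (x y z : Vec Bool n) → xor₃ ⊙ triple x y z ≡ x ⊕ (y ⊕ z)
xor₃-translate x y z = lookup-ext λ i → begin
  lookup (xor₃ ⊙ triple x y z) i           ≡⟨ lookup-⊙ xor₃ (triple x y z) i ⟩
  lookup x i xor lookup y i xor lookup z i ≡⟨ cong (lookup x i xor_) (lookup-zipWith _xor_ i y z) ⟨
  lookup x i xor lookup (y ⊕ z) i          ≡⟨ lookup-zipWith _xor_ i x (y ⊕ z) ⟨
  lookup (x ⊕ (y ⊕ z)) i                   ∎
  where open ≡-Reasoning

xor₃-cancel : ∀ {n} (a a' : Vec Bool n) → xor₃ ⊙ triple a a a' ≡ a'
xor₃-cancel a a' = lookup-ext λ i → begin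
  lookup (xor₃ ⊙ triple a a a') i             ≡⟨ lookup-⊙ xor₃ (triple a a a') i ⟩
  lookup a i xor lookup a i xor lookup a' i   ≡⟨ xor-assoc (lookup a i) _ _ ⟨
  (lookup a i xor lookup a i) xor lookup a' i ≡⟨ cong (_xor lookup a' i) (xor-same (lookup a i)) ⟩
  lookup a' i                                 ∎
  where open ≡-Reasoning

𝟙-mono : ∀ {p q} → (p ≡ true → q ≡ true) → 𝟙 p ≤ 𝟙 q
𝟙-mono {false}     _ = z≤n
𝟙-mono {true}  p⇒q rewrite p⇒q refl = ≤-refl

-- For affine R, if a and a' have extensions b₀ and b₀', then b ↦ b ⊕ (b₀ ⊕ b₀')
-- maps the extensions of a into those of a' (it is the action of xor₃ on
-- (a ++ b, a ++ b₀, a' ++ b₀')), and translations preserve sums.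
affine-count-mono : ∀ n m (R : Rel (n + m)) → Affine R → ∀ {a a' b₀ b₀'} →
  R (a ++ b₀) ≡ true → R (a' ++ b₀') ≡ true → count n m R a ≤ count n m R a'
affine-count-mono n m R aff {a} {a'} {b₀} {b₀'} h₀ h₀' = begin
  count n m R a                                 ≡⟨ count≡∑ n m R a ⟩
  ∑ m (λ b → 𝟙 (R (a ++ b)))                    ≤⟨ ∑-mono m (λ b → 𝟙-mono (moved b)) ⟩
  ∑ m (λ b → 𝟙 (R (a' ++ (b ⊕ (b₀ ⊕ b₀')))))    ≡⟨ ∑-translate m (λ b → 𝟙 (R (a' ++ b))) (b₀ ⊕ b₀') ⟩
  ∑ m (λ b → 𝟙 (R (a' ++ b)))                   ≡⟨ count≡∑ n m R a' ⟨
  count n m R a'                                ∎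
  where
  open ≤-Reasoning
  moved : ∀ b → R (a ++ b) ≡ true → R (a' ++ (b ⊕ (b₀ ⊕ b₀'))) ≡ true
  moved b h = subst (λ v → R v ≡ true)
    (trans (⊙-++ xor₃ (triple a a a') (triple b b₀ b₀'))
           (cong₂ _++_ (xor₃-cancel a a') (xor₃-translate b b₀ b₀')))
    (aff (λ j → triple a a a' j ++ triple b b₀ b₀' j)
         λ { zero → h ; (suc zero) → h₀ ; (suc (suc zero)) → h₀' })

count-none : ∀ n m (R : Rel (n + m)) a → (∀ b → R (a ++ b) ≡ false) → count n m R a ≡ 0
count-none n m R a none = trans (count≡∑ n m R a) (∑-zero m λ b → cong 𝟙 (none b))

count-some : ∀ n m (R : Rel (n + m)) a b → R (a ++ b) ≡ true → 1 ≤ count n m R a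
count-some n m R a b h = subst (λ t → 𝟙 t ≤ count n m R a) h
  (≤-trans (term≤∑ m (λ b → 𝟙 (R (a ++ b))) b) (≤-reflexive (sym (count≡∑ n m R a))))

affine-maxImpl : ∀ n m (R : Rel (n + m)) → Affine R → ∀ {a₀ b₀} → R (a₀ ++ b₀) ≡ true →
                 ∀ a → maxImpl n m R a ≡ exQ n m R a
affine-maxImpl n m R aff {a₀} {b₀} h₀ a with cube-dichotomy m (λ b → R (a ++ b))
... | inj₁ (b , h) = trans (maxImpl-complete n m R a maximal) (sym (any-cube⁺ m _ b h))
  where
  maximal : Maximal (count n m R) a
  maximal z with cube-dichotomy m (λ b → R (z ++ b))
  ... | inj₁ (_ , hz) = affine-count-mono n m R aff hz h
  ... | inj₂ none     = ≤-trans (≤-reflexive (count-none n m R z none)) z≤n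
... | inj₂ none = trans not-maximal (sym (any-none _ (allVecs m) none))
  where
  not-maximal : maxImpl n m R a ≡ false
  not-maximal with maxImpl n m R a in max
  ... | false = refl
  ... | true  = contradiction (≤-trans (count-some n m R a₀ b₀ h₀)
                  (≤-trans (maxImpl-sound n m R a max a₀) (≤-reflexive (count-none n m R a none))))
                  λ ()

empty-maxImpl : ∀ n m (R : Rel (n + m)) → (∀ a b → R (a ++ b) ≡ false) → ∀ a → maxImpl n m R a ≡ true
empty-maxImpl n m R empty a = maxImpl-complete n m R a λ z →
  ≤-trans (≤-reflexive (count-none n m R z (empty z))) z≤n

-- The total relation {0,1}^n is ∃ y₁ y₂ EQ(y₁, y₂), hence lies in every ⟪ Γ ⟫.
total∈⟪⟫ : ∀ {Γ : RelSet} n → ⟪ Γ ⟫ n (λ _ → true)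
total∈⟪⟫ n = ext (λ a → any-cube⁺ 2 (λ b → manip (n ↑ʳ_) EQ (a ++ b)) zeros (diagonal a))
                 (ex n 2 (man (n ↑ʳ_) eq))
  where
  zeros : Vec Bool 2
  zeros = false ∷ false ∷ []
  diagonal : ∀ a → manip (n ↑ʳ_) EQ (a ++ zeros) ≡ true
  diagonal a = subst₂ (λ u v → EQ (u ∷ v ∷ []) ≡ true)
    (sym (lookup-++ʳ a zeros zero)) (sym (lookup-++ʳ a zeros (suc zero))) refl

affine-closedMax : ∀ {Γ : RelSet} → (∀ {n R} → Γ n R → Affine R) →
                   ∀ n m (R : Rel (n + m)) → ⟪ Γ ⟫ (n + m) R → ⟪ Γ ⟫ n (maxImpl n m R)
affine-closedMax affΓ n m R r with cube-dichotomy n (exQ n m R)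
... | inj₁ (a₀ , sat) =
  ext (λ a → sym (affine-maxImpl n m R (preserves-⟪⟫ xor₃ affΓ r) {a₀} (proj₂ witness) a)) (ex n m r)
  where
  witness : Σ (Vec Bool m) λ b → R (a₀ ++ b) ≡ true
  witness = any-cube⁻ m _ sat
... | inj₂ empty =
  ext (λ a → sym (empty-maxImpl n m R (λ a' → any-cube-false m _ (empty a')) a)) (total∈⟪⟫ n)

affine-maxCoClone : ∀ {Γ : RelSet} → (∀ {n R} → Γ n R → Affine R) → MaxCoClone ⟪ Γ ⟫
affine-maxCoClone affΓ = record
  { hasEQ       = eq
  ; closedManip = λ f R r → man f r
  ; closedConj  = λ f g R S r s → cnj f g r s
  ; closedMax   = affine-closedMax affΓ
  }

Γ₂-affine : ∀ {n R} → Γ₂ n R → Affine R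
Γ₂-affine d₀ = affine-δ₀
Γ₂-affine d₁ = affine-δ₁

Γ₀-affine : ∀ {n R} → Γ₀ n R → Affine R
Γ₀-affine d₀ = affine-δ₀

Γ₁-affine : ∀ {n R} → Γ₁ n R → Affine R
Γ₁-affine d₁ = affine-δ₁

lemma23 : MaxCoClone IM₂ × MaxCoClone IR₂ × MaxCoClone IR₀ × MaxCoClone IR₁
lemma23 =
  IM₂-maxCoClone ,
  affine-maxCoClone Γ₂-affine ,
  affine-maxCoClone Γ₀-affine ,
  affine-maxCoClone Γ₁-affine
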